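{- Let $p$ be a prime, let $X\subset\mathbb{Z}_p$ and $k\in\mathbb{N}$. Then $$|kX|\geq|X|^{2^{1-k}}|X-X|^{1-2^{1-k}}.$$
   Context: $\mathbb{Z}_p$ is the field of residues modulo $p$; $kX=\{x_1+\dots+x_k:\ x_i\in X\}$ and $X-X=\{x_1-x_2:\ x_1,x_2\in X\}$. -}

module Defs where

open import Data.Nat using (ℕ; zero; suc; _+_; _∸_; NonZero)
open import Data.Nat.DivMod using (_mod_)
open import Data.Fin using (Fin; toℕ)
open import Data.Fin.Subset using (Subset; _∈_; ⁅_⁆)
open import Data.Fin.Subset.Properties using (_∈?_)
open import Data.Fin.Properties using (any?; _≟_)
open import Data.Vec using (tabulate)
open import Data.Product using (_×_)
open import Relation.Nullary.Decidable using (⌊_⌋; _×-dec_)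

-- ℤ_p is modelled as Fin p, with arithmetic modulo p.
module _ {p : ℕ} .{{_ : NonZero p}} where

  zeroₚ : Fin p
  zeroₚ = 0 mod p

  _+ₚ_ : Fin p → Fin p → Fin p
  a +ₚ b = (toℕ a + toℕ b) mod p

  _-ₚ_ : Fin p → Fin p → Fin p
  a -ₚ b = (toℕ a + (p ∸ toℕ b)) mod p

  _⊕_ : Subset p → Subset p → Subset p
  A ⊕ B = tabulate λ z → ⌊ any? (λ a → any? (λ b →
            (a ∈? A) ×-dec ((b ∈? B) ×-dec ((a +ₚ b) ≟ z)))) ⌋

  _⊖_ : Subset p → Subset p → Subset p
  A ⊖ B = tabulate λ z → ⌊ any? (λ a → any? (λ b →
            (a ∈? A) ×-dec ((b ∈? B) ×-dec ((a -ₚ b) ≟ z)))) ⌋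

  -- kX = { x₁ + … + x_k : xᵢ ∈ X };  0X = {0}, (k+1)X = kX + X
  _·_ : ℕ → Subset p → Subset p
  zero · X = ⁅ zeroₚ ⁆
  suc k · X = (k · X) ⊕ X

{-# OPTIONS --safe #-}

-- Ruzsa's triangle inequality |A| |B − C| ≤ |A + B| |A + C| (an injection A × (B − C) → (A + B) × (A + C),
-- valid in any abelian group) with A = kX and B = C = X gives |kX| |X − X| ≤ |(k+1)X|². Iterating this
-- squaring step from |X| ≤ |1X| accumulates 2^(k−1) − 1 factors |X − X| against |kX|^(2^(k−1)).

module Submission where

open import Defs
open import Data.Nat using (ℕ; _*_; _^_; _∸_; _≤_; _≥_; NonZero)
open import Data.Nat.Primality using (Prime)
open import Data.Fin.Subset using (Subset; ∣_∣)

open import Algebra.Properties.CommutativeSemigroup using (interchange)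
open import Data.Bool.Properties using (T-≡)
open import Data.Nat using (zero; suc; _+_; _%_)
open import Data.Nat.DivMod using (_mod_; %-distribˡ-+; m%n%n≡m%n; [m+n]%n≡m%n; m%n<n; m<n⇒m%n≡m)
open import Data.Nat.Properties
  using (+-comm; +-assoc; +-identityʳ; m∸n+n≡m; m+[n∸m]≡n; *-identityʳ; *-assoc; *-monoˡ-≤; ^-monoˡ-≤; ^-distribˡ-+-*; ^-*-assoc;
         m^n>0; +-∸-comm; *-commutativeSemigroup; module ≤-Reasoning)
open import Data.Fin using (Fin; toℕ)
open import Data.Fin.Properties using (toℕ-fromℕ<; toℕ-injective; toℕ<n; toℕ≤n; suc-injective; injective⇒≤; *↔×; any?)
open import Data.Fin.Subset using (_∈_; _⊆_; inside; outside)
open import Data.Fin.Subset.Properties using (p⊆q⇒∣p∣≤∣q∣; x∈⁅x⁆)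
open import Data.Product using (_×_; _,_; ∃₂; proj₁; proj₂)
open import Data.Vec using (_∷_; here; there; tabulate)
open import Data.Vec.Properties using ([]=⇒lookup; lookup⇒[]=; lookup∘tabulate)
open import Function using (Injective; mk↣; Injection; Equivalence)
open import Function.Construct.Composition using (_↣-∘_)
open import Function.Construct.Symmetry using (↔-sym)
open import Function.Properties.Inverse using (↔⇒↣)
open import Relation.Nullary using (Dec)
open import Relation.Nullary.Decidable using (⌊_⌋; toWitness; fromWitness)
open import Relation.Binary.PropositionalEquality using (_≡_; refl; sym; trans; cong; cong₂; subst; module ≡-Reasoning)

private
  variable
    n : ℕ

module _ {P : Fin n → Set} (P? : ∀ x → Dec (P x)) where

  ∈-tabulate⁺ : ∀ {x} → P x → x ∈ tabulate (λ y → ⌊ P? y ⌋)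
  ∈-tabulate⁺ {x} px = lookup⇒[]= x _ (trans (lookup∘tabulate _ x) (Equivalence.to T-≡ (fromWitness px)))

  ∈-tabulate⁻ : ∀ {x} → x ∈ tabulate (λ y → ⌊ P? y ⌋) → P x
  ∈-tabulate⁻ {x} x∈ =
    toWitness {a? = P? x} (Equivalence.from T-≡ (trans (sym (lookup∘tabulate _ x)) ([]=⇒lookup x∈)))

element : (S : Subset n) → Fin ∣ S ∣ → Fin n
element (inside ∷ S) Fin.zero = Fin.zero
element (inside ∷ S) (Fin.suc i) = Fin.suc (element S i)
element (outside ∷ S) i = Fin.suc (element S i)

element-∈ : (S : Subset n) (i : Fin ∣ S ∣) → element S i ∈ S
element-∈ (inside ∷ S) Fin.zero = here
element-∈ (inside ∷ S) (Fin.suc i) = there (element-∈ S i)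
element-∈ (outside ∷ S) i = there (element-∈ S i)

element-injective : (S : Subset n) → Injective _≡_ _≡_ (element S)
element-injective (inside ∷ S) {Fin.zero} {Fin.zero} _ = refl
element-injective (inside ∷ S) {Fin.suc i} {Fin.suc j} eq = cong Fin.suc (element-injective S (suc-injective eq))
element-injective (outside ∷ S) eq = element-injective S (suc-injective eq)

rank : (S : Subset n) {x : Fin n} → x ∈ S → Fin ∣ S ∣
rank (inside ∷ S) here = Fin.zero
rank (inside ∷ S) (there x∈S) = Fin.suc (rank S x∈S)
rank (outside ∷ S) (there x∈S) = rank S x∈S

element-rank : (S : Subset n) {x : Fin n} (x∈S : x ∈ S) → element S (rank S x∈S) ≡ x
element-rank (inside ∷ S) here = refl
element-rank (inside ∷ S) (there x∈S) = cong Fin.suc (element-rank S x∈S)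
element-rank (outside ∷ S) (there x∈S) = cong Fin.suc (element-rank S x∈S)

rank-injective : (S : Subset n) {x y : Fin n} (x∈S : x ∈ S) (y∈S : y ∈ S) → rank S x∈S ≡ rank S y∈S → x ≡ y
rank-injective S x∈S y∈S eq = trans (sym (element-rank S x∈S)) (trans (cong (element S) eq) (element-rank S y∈S))

×-injective⇒*-≤ : ∀ {a b c d} {f : Fin a × Fin b → Fin c × Fin d} → Injective _≡_ _≡_ f → a * b ≤ c * d
×-injective⇒*-≤ {f = f} f-injective =
  injective⇒≤ (Injection.injective (↔⇒↣ (↔-sym *↔×) ↣-∘ (mk↣ f-injective ↣-∘ ↔⇒↣ *↔×)))

^-distribʳ-* : ∀ m n o → (m * n) ^ o ≡ m ^ o * n ^ o
^-distribʳ-* m n zero = refl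
^-distribʳ-* m n (suc o) = begin
  m * n * (m * n) ^ o      ≡⟨ cong (m * n *_) (^-distribʳ-* m n o) ⟩
  m * n * (m ^ o * n ^ o)  ≡⟨ interchange *-commutativeSemigroup m n (m ^ o) (n ^ o) ⟩
  m * m ^ o * (n * n ^ o)  ∎
  where open ≡-Reasoning

2^[1+m]∸1≡[2^m∸1]+2^m : ∀ m → 2 ^ suc m ∸ 1 ≡ (2 ^ m ∸ 1) + 2 ^ m
2^[1+m]∸1≡[2^m∸1]+2^m m = begin
  2 ^ suc m ∸ 1           ≡⟨ cong (λ r → (2 ^ m + r) ∸ 1) (+-identityʳ (2 ^ m)) ⟩
  (2 ^ m + 2 ^ m) ∸ 1     ≡⟨ +-∸-comm (2 ^ m) (m^n>0 2 m) ⟩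
  (2 ^ m ∸ 1) + 2 ^ m     ∎
  where open ≡-Reasoning

repeated-squaring-≤ : (s : ℕ → ℕ) {x d : ℕ} → x ≤ s 0 → (∀ m → s m * d ≤ s (suc m) ^ 2) →
                      ∀ m → x * d ^ (2 ^ m ∸ 1) ≤ s m ^ (2 ^ m)
repeated-squaring-≤ s x≤s₀ step zero = *-monoˡ-≤ 1 x≤s₀
repeated-squaring-≤ s {x} {d} x≤s₀ step (suc m) = begin
  x * d ^ (2 ^ suc m ∸ 1)               ≡⟨ cong (λ e → x * d ^ e) (2^[1+m]∸1≡[2^m∸1]+2^m m) ⟩
  x * d ^ ((2 ^ m ∸ 1) + 2 ^ m)         ≡⟨ cong (x *_) (^-distribˡ-+-* d (2 ^ m ∸ 1) (2 ^ m)) ⟩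
  x * (d ^ (2 ^ m ∸ 1) * d ^ (2 ^ m))   ≡⟨ *-assoc x _ _ ⟨
  x * d ^ (2 ^ m ∸ 1) * d ^ (2 ^ m)     ≤⟨ *-monoˡ-≤ (d ^ (2 ^ m)) (repeated-squaring-≤ s x≤s₀ step m) ⟩
  s m ^ (2 ^ m) * d ^ (2 ^ m)           ≡⟨ ^-distribʳ-* (s m) d (2 ^ m) ⟨
  (s m * d) ^ (2 ^ m)                   ≤⟨ ^-monoˡ-≤ (2 ^ m) (step m) ⟩
  (s (suc m) ^ 2) ^ (2 ^ m)             ≡⟨ ^-*-assoc (s (suc m)) 2 (2 ^ m) ⟩
  s (suc m) ^ (2 ^ suc m)               ∎
  where open ≤-Reasoning

module _ {p : ℕ} .{{_ : NonZero p}} where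

  [m%p+n]%p≡[m+n]%p : ∀ m n → (m % p + n) % p ≡ (m + n) % p
  [m%p+n]%p≡[m+n]%p m n = begin
    (m % p + n) % p            ≡⟨ %-distribˡ-+ (m % p) n p ⟩
    (m % p % p + n % p) % p    ≡⟨ cong (λ r → (r + n % p) % p) (m%n%n≡m%n m p) ⟩
    (m % p + n % p) % p        ≡⟨ %-distribˡ-+ m n p ⟨
    (m + n) % p                ∎
    where open ≡-Reasoning

  toℕ-mod : ∀ m → toℕ (m mod p) ≡ m % p
  toℕ-mod m = toℕ-fromℕ< (m%n<n m p)

  toℕ%p≡toℕ : (a : Fin p) → toℕ a % p ≡ toℕ a
  toℕ%p≡toℕ a = m<n⇒m%n≡m (toℕ<n a)

  mod-cong : ∀ {m n} → m % p ≡ n % p → m mod p ≡ n mod p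
  mod-cong {m} {n} m≡n = toℕ-injective (trans (toℕ-mod m) (trans m≡n (sym (toℕ-mod n))))

  +ₚ-comm : (a b : Fin p) → a +ₚ b ≡ b +ₚ a
  +ₚ-comm a b = cong (_mod p) (+-comm (toℕ a) (toℕ b))

  +ₚ-assoc : (a b c : Fin p) → (a +ₚ b) +ₚ c ≡ a +ₚ (b +ₚ c)
  +ₚ-assoc a b c = mod-cong (begin
    (toℕ (a +ₚ b) + toℕ c) % p       ≡⟨ cong (λ r → (r + toℕ c) % p) (toℕ-mod (toℕ a + toℕ b)) ⟩
    ((toℕ a + toℕ b) % p + toℕ c) % p ≡⟨ [m%p+n]%p≡[m+n]%p (toℕ a + toℕ b) (toℕ c) ⟩
    (toℕ a + toℕ b + toℕ c) % p      ≡⟨ cong (_% p) (+-assoc (toℕ a) (toℕ b) (toℕ c)) ⟩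
    (toℕ a + (toℕ b + toℕ c)) % p    ≡⟨ cong (_% p) (+-comm (toℕ a) (toℕ b + toℕ c)) ⟩
    (toℕ b + toℕ c + toℕ a) % p      ≡⟨ [m%p+n]%p≡[m+n]%p (toℕ b + toℕ c) (toℕ a) ⟨
    ((toℕ b + toℕ c) % p + toℕ a) % p ≡⟨ cong (λ r → (r + toℕ a) % p) (toℕ-mod (toℕ b + toℕ c)) ⟨
    (toℕ (b +ₚ c) + toℕ a) % p       ≡⟨ cong (_% p) (+-comm (toℕ (b +ₚ c)) (toℕ a)) ⟩
    (toℕ a + toℕ (b +ₚ c)) % p       ∎)
    where open ≡-Reasoning

  +ₚ-identityˡ : (a : Fin p) → zeroₚ +ₚ a ≡ a
  +ₚ-identityˡ a = toℕ-injective (begin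
    toℕ (zeroₚ +ₚ a)                  ≡⟨ toℕ-mod (toℕ (zeroₚ {p}) + toℕ a) ⟩
    (toℕ (zeroₚ {p}) + toℕ a) % p     ≡⟨ cong (λ r → (r + toℕ a) % p) (toℕ-mod 0) ⟩
    (0 % p + toℕ a) % p               ≡⟨ [m%p+n]%p≡[m+n]%p 0 (toℕ a) ⟩
    toℕ a % p                         ≡⟨ toℕ%p≡toℕ a ⟩
    toℕ a                             ∎)
    where open ≡-Reasoning

  a-ₚb+ₚb≡a : (a b : Fin p) → (a -ₚ b) +ₚ b ≡ a
  a-ₚb+ₚb≡a a b = toℕ-injective (begin
    toℕ ((a -ₚ b) +ₚ b)                     ≡⟨ toℕ-mod _ ⟩
    (toℕ (a -ₚ b) + toℕ b) % p              ≡⟨ cong (λ r → (r + toℕ b) % p) (toℕ-mod _) ⟩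
    ((toℕ a + (p ∸ toℕ b)) % p + toℕ b) % p ≡⟨ [m%p+n]%p≡[m+n]%p (toℕ a + (p ∸ toℕ b)) (toℕ b) ⟩
    (toℕ a + (p ∸ toℕ b) + toℕ b) % p       ≡⟨ cong (_% p) (+-assoc (toℕ a) (p ∸ toℕ b) (toℕ b)) ⟩
    (toℕ a + ((p ∸ toℕ b) + toℕ b)) % p     ≡⟨ cong (λ r → (toℕ a + r) % p) (m∸n+n≡m (toℕ≤n b)) ⟩
    (toℕ a + p) % p                         ≡⟨ [m+n]%n≡m%n (toℕ a) p ⟩
    toℕ a % p                               ≡⟨ toℕ%p≡toℕ a ⟩
    toℕ a                                   ∎)
    where open ≡-Reasoning

  a+ₚb-ₚb≡a : (a b : Fin p) → (a +ₚ b) -ₚ b ≡ a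
  a+ₚb-ₚb≡a a b = toℕ-injective (begin
    toℕ ((a +ₚ b) -ₚ b)                         ≡⟨ toℕ-mod _ ⟩
    (toℕ (a +ₚ b) + (p ∸ toℕ b)) % p            ≡⟨ cong (λ r → (r + (p ∸ toℕ b)) % p) (toℕ-mod _) ⟩
    ((toℕ a + toℕ b) % p + (p ∸ toℕ b)) % p     ≡⟨ [m%p+n]%p≡[m+n]%p (toℕ a + toℕ b) (p ∸ toℕ b) ⟩
    (toℕ a + toℕ b + (p ∸ toℕ b)) % p           ≡⟨ cong (_% p) (+-assoc (toℕ a) (toℕ b) (p ∸ toℕ b)) ⟩
    (toℕ a + (toℕ b + (p ∸ toℕ b))) % p         ≡⟨ cong (λ r → (toℕ a + r) % p) (m+[n∸m]≡n (toℕ≤n b)) ⟩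
    (toℕ a + p) % p                             ≡⟨ [m+n]%n≡m%n (toℕ a) p ⟩
    toℕ a % p                                   ≡⟨ toℕ%p≡toℕ a ⟩
    toℕ a                                       ∎)
    where open ≡-Reasoning

  [a+ₚb]-ₚ[a+ₚc]≡b-ₚc : (a b c : Fin p) → (a +ₚ b) -ₚ (a +ₚ c) ≡ b -ₚ c
  [a+ₚb]-ₚ[a+ₚc]≡b-ₚc a b c = begin
    (a +ₚ b) -ₚ (a +ₚ c)                  ≡⟨ cong (_-ₚ (a +ₚ c)) b-ₚc+ₚ[a+ₚc]≡a+ₚb ⟨
    ((b -ₚ c) +ₚ (a +ₚ c)) -ₚ (a +ₚ c)    ≡⟨ a+ₚb-ₚb≡a (b -ₚ c) (a +ₚ c) ⟩
    b -ₚ c                                ∎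
    where
    open ≡-Reasoning
    b-ₚc+ₚ[a+ₚc]≡a+ₚb : (b -ₚ c) +ₚ (a +ₚ c) ≡ a +ₚ b
    b-ₚc+ₚ[a+ₚc]≡a+ₚb = begin
      (b -ₚ c) +ₚ (a +ₚ c)  ≡⟨ cong ((b -ₚ c) +ₚ_) (+ₚ-comm a c) ⟩
      (b -ₚ c) +ₚ (c +ₚ a)  ≡⟨ +ₚ-assoc (b -ₚ c) c a ⟨
      ((b -ₚ c) +ₚ c) +ₚ a  ≡⟨ cong (_+ₚ a) (a-ₚb+ₚb≡a b c) ⟩
      b +ₚ a                ≡⟨ +ₚ-comm b a ⟩
      a +ₚ b                ∎

  ∈-⊕⁺ : ∀ {A B : Subset p} {a b} → a ∈ A → b ∈ B → a +ₚ b ∈ A ⊕ B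
  ∈-⊕⁺ {a = a} {b} a∈A b∈B = ∈-tabulate⁺ (λ _ → any? _) (a , b , a∈A , b∈B , refl)

  ∈-⊖⁻ : ∀ {A B : Subset p} {z} → z ∈ A ⊖ B → ∃₂ λ a b → a ∈ A × b ∈ B × a -ₚ b ≡ z
  ∈-⊖⁻ = ∈-tabulate⁻ (λ _ → any? _)

  X⊆1·X : (X : Subset p) → X ⊆ 1 · X
  X⊆1·X X {x} x∈X = subst (_∈ 1 · X) (+ₚ-identityˡ x) (∈-⊕⁺ (x∈⁅x⁆ zeroₚ) x∈X)

  -- With each difference written as bⱼ -ₚ cⱼ, the pair (a +ₚ bⱼ, a +ₚ cⱼ) determines the difference
  -- (a +ₚ bⱼ) -ₚ (a +ₚ cⱼ), hence j, and then a.
  ruzsa-triangle : (A B C : Subset p) → ∣ A ∣ * ∣ B ⊖ C ∣ ≤ ∣ A ⊕ B ∣ * ∣ A ⊕ C ∣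
  ruzsa-triangle A B C = ×-injective⇒*-≤ {f = φ} φ-injective
    where
    open ≡-Reasoning

    a : Fin ∣ A ∣ → Fin p
    a = element A

    d : Fin ∣ B ⊖ C ∣ → Fin p
    d = element (B ⊖ C)

    representation : ∀ j → ∃₂ λ b c → b ∈ B × c ∈ C × b -ₚ c ≡ d j
    representation j = ∈-⊖⁻ (element-∈ (B ⊖ C) j)

    b c : Fin ∣ B ⊖ C ∣ → Fin p
    b j with b′ , _ ← representation j = b′
    c j with _ , c′ , _ ← representation j = c′

    b∈B : ∀ j → b j ∈ B
    b∈B j with _ , _ , b∈ , _ ← representation j = b∈

    c∈C : ∀ j → c j ∈ C
    c∈C j with _ , _ , _ , c∈ , _ ← representation j = c∈

    b-ₚc≡d : ∀ j → b j -ₚ c j ≡ d j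
    b-ₚc≡d j with _ , _ , _ , _ , eq ← representation j = eq

    a+ₚb∈A⊕B : ∀ i j → a i +ₚ b j ∈ A ⊕ B
    a+ₚb∈A⊕B i j = ∈-⊕⁺ (element-∈ A i) (b∈B j)

    a+ₚc∈A⊕C : ∀ i j → a i +ₚ c j ∈ A ⊕ C
    a+ₚc∈A⊕C i j = ∈-⊕⁺ (element-∈ A i) (c∈C j)

    φ : Fin ∣ A ∣ × Fin ∣ B ⊖ C ∣ → Fin ∣ A ⊕ B ∣ × Fin ∣ A ⊕ C ∣
    φ (i , j) = rank (A ⊕ B) (a+ₚb∈A⊕B i j) , rank (A ⊕ C) (a+ₚc∈A⊕C i j)

    module _ {i i′ j j′} (eq : φ (i , j) ≡ φ (i′ , j′)) where

      a+ₚb≡a′+ₚb′ : a i +ₚ b j ≡ a i′ +ₚ b j′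
      a+ₚb≡a′+ₚb′ = rank-injective (A ⊕ B) (a+ₚb∈A⊕B i j) (a+ₚb∈A⊕B i′ j′) (cong proj₁ eq)

      a+ₚc≡a′+ₚc′ : a i +ₚ c j ≡ a i′ +ₚ c j′
      a+ₚc≡a′+ₚc′ = rank-injective (A ⊕ C) (a+ₚc∈A⊕C i j) (a+ₚc∈A⊕C i′ j′) (cong proj₂ eq)

      d≡d′ : d j ≡ d j′
      d≡d′ = begin
        d j                                ≡⟨ b-ₚc≡d j ⟨
        b j -ₚ c j                         ≡⟨ [a+ₚb]-ₚ[a+ₚc]≡b-ₚc (a i) (b j) (c j) ⟨
        (a i +ₚ b j) -ₚ (a i +ₚ c j)       ≡⟨ cong₂ _-ₚ_ a+ₚb≡a′+ₚb′ a+ₚc≡a′+ₚc′ ⟩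
        (a i′ +ₚ b j′) -ₚ (a i′ +ₚ c j′)   ≡⟨ [a+ₚb]-ₚ[a+ₚc]≡b-ₚc (a i′) (b j′) (c j′) ⟩
        b j′ -ₚ c j′                       ≡⟨ b-ₚc≡d j′ ⟩
        d j′                               ∎

      j≡j′ : j ≡ j′
      j≡j′ = element-injective (B ⊖ C) d≡d′

      a≡a′ : a i ≡ a i′
      a≡a′ = begin
        a i                    ≡⟨ a+ₚb-ₚb≡a (a i) (b j) ⟨
        (a i +ₚ b j) -ₚ b j    ≡⟨ cong₂ _-ₚ_ a+ₚb≡a′+ₚb′ (cong b j≡j′) ⟩
        (a i′ +ₚ b j′) -ₚ b j′ ≡⟨ a+ₚb-ₚb≡a (a i′) (b j′) ⟩
        a i′                   ∎

    φ-injective : Injective _≡_ _≡_ φ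
    φ-injective eq = cong₂ _,_ (element-injective A (a≡a′ eq)) (j≡j′ eq)

  ∣[1+k]·X∣*∣X⊖X∣≤∣[2+k]·X∣² : (X : Subset p) (k : ℕ) → ∣ suc k · X ∣ * ∣ X ⊖ X ∣ ≤ ∣ suc (suc k) · X ∣ ^ 2
  ∣[1+k]·X∣*∣X⊖X∣≤∣[2+k]·X∣² X k = begin
    ∣ suc k · X ∣ * ∣ X ⊖ X ∣  ≤⟨ ruzsa-triangle (suc k · X) X X ⟩
    T * T                      ≡⟨ cong (T *_) (*-identityʳ T) ⟨
    T ^ 2                      ∎
    where
    open ≤-Reasoning
    T : ℕ
    T = ∣ suc (suc k) · X ∣

corollary7 : (p : ℕ) {{_ : NonZero p}} → Prime p → (X : Subset p) → (k : ℕ) → 1 ≤ k →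
    ∣ k · X ∣ ^ (2 ^ (k ∸ 1)) ≥ ∣ X ∣ * ∣ X ⊖ X ∣ ^ (2 ^ (k ∸ 1) ∸ 1)
corollary7 p _ X (suc m) _ =
  repeated-squaring-≤ (λ i → ∣ suc i · X ∣) (p⊆q⇒∣p∣≤∣q∣ (X⊆1·X X)) (∣[1+k]·X∣*∣X⊖X∣≤∣[2+k]·X∣² X) m
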